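{- Let $n\ge 1$. Let $H_n$ be the graph consisting of a complete bipartite graph $K_{n,n}$ with parts $L,R$, together with two further vertices $v_l,v_r$ and the edges $(v_l,v)$ for all $v\in L$ and $(v_r,v)$ for all $v\in R$. Let $G_n$ be the graph obtained from $H_n$ by adding two new vertices $x_1,x_2$ (not in $H_n$) and the edges $e_l=(x_1,v_l)$ and $e_r=(x_2,v_r)$. Then $G_n$ is $(n+1)$-edge-colorable, and every proper edge coloring of $G_n$ in which $e_l$ and $e_r$ receive different colors uses at least $n+2$ colors.
   Context: A proper edge coloring assigns colors to edges so that edges sharing an endpoint receive different colors; a graph is $k$-edge-colorable if it has a proper edge coloring with at most $k$ colors. -}

module Defs where

open import Data.Nat using (ℕ)
open import Data.Fin using (Fin)
open import Data.Empty using (⊥)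
open import Data.Unit using (⊤)
open import Relation.Binary.PropositionalEquality using (_≡_)
open import Relation.Nullary using (¬_)

record Graph (V : Set) : Set₁ where
  field
    Adj   : V → V → Set
    sym   : ∀ {u v} → Adj u v → Adj v u
    irrefl : ∀ {v} → ¬ Adj v v
open Graph public

-- An edge coloring with (at most) k colors (colors are Fin k).  The edge {u,v}
-- gets the color col u v p, which must not depend on orientation or proof.
record EdgeColoring {V : Set} (G : Graph V) (k : ℕ) : Set where
  field
    col     : (u v : V) → Adj G u v → Fin k
    col-sym : ∀ u v (p : Adj G u v) (q : Adj G v u) → col u v p ≡ col v u q
    proper  : ∀ u v w (p : Adj G u v) (q : Adj G u w) → ¬ v ≡ w → ¬ col u v p ≡ col u w q
open EdgeColoring public

EdgeColorable : {V : Set} → Graph V → ℕ → Set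
EdgeColorable G k = EdgeColoring G k

data GV (n : ℕ) : Set where
  l r : Fin n → GV n
  vl vr x₁ x₂ : GV n

GAdj : {n : ℕ} → GV n → GV n → Set
GAdj (l i) (r j) = ⊤
GAdj (r j) (l i) = ⊤
GAdj vl (l i) = ⊤
GAdj (l i) vl = ⊤
GAdj vr (r j) = ⊤
GAdj (r j) vr = ⊤
GAdj x₁ vl = ⊤
GAdj vl x₁ = ⊤
GAdj x₂ vr = ⊤
GAdj vr x₂ = ⊤
GAdj _ _ = ⊥

GAdj-sym : {n : ℕ} {u v : GV n} → GAdj u v → GAdj v u
GAdj-sym {u = l i} {r j} _ = _
GAdj-sym {u = r j} {l i} _ = _
GAdj-sym {u = vl} {l i} _ = _
GAdj-sym {u = l i} {vl} _ = _
GAdj-sym {u = vr} {r j} _ = _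
GAdj-sym {u = r j} {vr} _ = _
GAdj-sym {u = x₁} {vl} _ = _
GAdj-sym {u = vl} {x₁} _ = _
GAdj-sym {u = x₂} {vr} _ = _
GAdj-sym {u = vr} {x₂} _ = _

GAdj-irrefl : {n : ℕ} {v : GV n} → ¬ GAdj v v
GAdj-irrefl {v = l i} ()
GAdj-irrefl {v = r i} ()
GAdj-irrefl {v = vl} ()
GAdj-irrefl {v = vr} ()
GAdj-irrefl {v = x₁} ()
GAdj-irrefl {v = x₂} ()

G : (n : ℕ) → Graph (GV n)
G n = record { Adj = GAdj ; sym = GAdj-sym ; irrefl = GAdj-irrefl }

colorOf-el : {n k : ℕ} → EdgeColoring (G n) k → Fin k
colorOf-el c = col c x₁ vl _

colorOf-er : {n k : ℕ} → EdgeColoring (G n) k → Fin k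
colorOf-er c = col c x₂ vr _

-- Upper bound: label L and R by Fin n inside Fin (n + 1) and the four extra vertices by n;
-- this labelling is injective on every neighbourhood, so colouring each edge by the sum of its
-- end labels modulo n + 1 is proper.
-- Lower bound: with at most n + 1 colours every vertex of degree n + 1 sees every colour.  The
-- colour α of e_l cannot sit on an edge v_l L, so each ℓ ∈ L has an α-edge into R, and these
-- edges form a matching L → R.  Likewise v_r has an α-edge into R, because e_r is not coloured α;
-- the matching must avoid its endpoint, mapping n vertices injectively into n - 1.
module Submission where

open import Defs hiding (sym)
open import Data.Nat using (ℕ; _≤_; _+_)
open import Relation.Binary.PropositionalEquality using (_≡_)
open import Relation.Nullary using (¬_)
open import Data.Product using (_×_)

open import Data.Nat using (suc; s≤s; _<_; _%_; _*_; _≤?_)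
open import Data.Nat.Properties using (+-comm; +-assoc; *-suc; <-irrefl; ≤⇒≯; ≰⇒>; ≤-pred)
open import Data.Nat.DivMod using (m%n<n; m<n⇒m%n≡m; [m+kn]%n≡m%n; %-distribˡ-+)
open import Data.Fin using (Fin; zero; suc; toℕ; fromℕ; fromℕ<; inject₁; punchOut)
open import Data.Fin.Properties
  using (toℕ<n; toℕ-injective; toℕ-fromℕ<; fromℕ≢inject₁; inject₁-injective; punchOut-injective; injective⇒≤; any?; _≟_)
open import Data.Vec.Functional using (_∷_)
open import Data.Product using (_,_; proj₁; proj₂; ∃)
open import Data.Empty using (⊥; ⊥-elim)
open import Function using (_∘_)
open import Function.Definitions using (Injective)
open import Relation.Binary.Definitions using (DecidableEquality)
open import Relation.Binary.PropositionalEquality using (_≢_; refl; sym; trans; cong; subst; module ≡-Reasoning)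
open import Relation.Nullary using (yes; no; contradiction)
open import Relation.Nullary.Decidable using (decidable-stable)

+-cancelˡ-% : ∀ {m} a {x y} → x < suc m → y < suc m → (a + x) % suc m ≡ (a + y) % suc m → x ≡ y
+-cancelˡ-% {m} a {x} {y} x<m y<m ax≡ay = trans (recover x<m) (trans (cong shift ax≡ay) (sym (recover y<m)))
  where
  open ≡-Reasoning
  -- Adding a * m undoes the shift by a, since a + a * m is a multiple of m + 1.
  shift : ℕ → ℕ
  shift z = (z + (a * m) % suc m) % suc m

  recover : ∀ {z} → z < suc m → z ≡ shift ((a + z) % suc m)
  recover {z} z<m = begin
    z                            ≡⟨ sym (m<n⇒m%n≡m z<m) ⟩
    z % suc m                    ≡⟨ sym ([m+kn]%n≡m%n z a (suc m)) ⟩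
    (z + a * suc m) % suc m      ≡⟨ cong (λ t → (z + t) % suc m) (*-suc a m) ⟩
    (z + (a + a * m)) % suc m    ≡⟨ cong (_% suc m) (sym (+-assoc z a (a * m))) ⟩
    (z + a + a * m) % suc m      ≡⟨ cong (λ t → (t + a * m) % suc m) (+-comm z a) ⟩
    (a + z + a * m) % suc m      ≡⟨ %-distribˡ-+ (a + z) (a * m) (suc m) ⟩
    shift ((a + z) % suc m)      ∎

_⊕_ : ∀ {m} → Fin (suc m) → Fin (suc m) → Fin (suc m)
_⊕_ {m} i j = fromℕ< (m%n<n (toℕ i + toℕ j) (suc m))

⊕-comm : ∀ {m} (i j : Fin (suc m)) → i ⊕ j ≡ j ⊕ i
⊕-comm i j = cong (λ s → fromℕ< (m%n<n s _)) (+-comm (toℕ i) (toℕ j))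

toℕ-⊕ : ∀ {m} (i j : Fin (suc m)) → toℕ (i ⊕ j) ≡ (toℕ i + toℕ j) % suc m
toℕ-⊕ {m} i j = toℕ-fromℕ< (m%n<n (toℕ i + toℕ j) (suc m))

⊕-cancelˡ : ∀ {m} (i : Fin (suc m)) {j k : Fin (suc m)} → i ⊕ j ≡ i ⊕ k → j ≡ k
⊕-cancelˡ i {j} {k} i⊕j≡i⊕k = toℕ-injective (+-cancelˡ-% (toℕ i) (toℕ<n j) (toℕ<n k)
  (trans (sym (toℕ-⊕ i j)) (trans (cong toℕ i⊕j≡i⊕k) (toℕ-⊕ i k))))

LocallyInjective : {V A : Set} → Graph V → (V → A) → Set
LocallyInjective Γ f = ∀ {u v w} → Adj Γ u v → Adj Γ u w → f v ≡ f w → v ≡ w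

labelSumColoring : ∀ {V : Set} {Γ : Graph V} {m} (label : V → Fin (suc m)) →
                   LocallyInjective Γ label → EdgeColoring Γ (suc m)
labelSumColoring label locallyInjective = record
  { col     = λ u v _ → label u ⊕ label v
  ; col-sym = λ u v _ _ → ⊕-comm (label u) (label v)
  ; proper  = λ u v w p q v≢w same → v≢w (locallyInjective p q (⊕-cancelˡ (label u) same))
  }

injective-avoiding⇒< : ∀ {a b} (f : Fin a → Fin b) → Injective _≡_ _≡_ f →
                       (y : Fin b) → (∀ x → f x ≢ y) → a < b
injective-avoiding⇒< {b = suc _} f f-injective y avoids = s≤s (injective⇒≤ punchOut-f-injective)
  where
  punchOut-f-injective : Injective _≡_ _≡_ (λ x → punchOut (avoids x ∘ sym))
  punchOut-f-injective {x} {x′} = f-injective ∘ punchOut-injective (avoids x ∘ sym) (avoids x′ ∘ sym)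

module _ {V : Set} {Γ : Graph V} {k : ℕ} (c : EdgeColoring Γ k) where

  col-injective : ∀ {I : Set} {u} → DecidableEquality I → (nb : I → V) → Injective _≡_ _≡_ nb →
                  (adj : ∀ x → Adj Γ u (nb x)) → Injective _≡_ _≡_ (λ x → col c u (nb x) (adj x))
  col-injective _≟ᴵ_ nb nb-injective adj {x} {y} same =
    decidable-stable (x ≟ᴵ y) (λ x≢y → proper c _ _ _ (adj x) (adj y) (x≢y ∘ nb-injective) same)

  every-colour-at : ∀ {d u} (nb : Fin d → V) → Injective _≡_ _≡_ nb → (adj : ∀ x → Adj Γ u (nb x)) →
                    k ≤ d → ∀ α → ∃ λ x → col c u (nb x) (adj x) ≡ α
  every-colour-at nb nb-injective adj k≤d α with any? (λ x → col c _ (nb x) (adj x) ≟ α)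
  ... | yes found = found
  ... | no missing = contradiction
    (injective-avoiding⇒< _ (col-injective _≟_ nb nb-injective adj) α (λ x e → missing (x , e)))
    (≤⇒≯ k≤d)

position : ∀ {n} → GV n → Fin (suc n)
position (l i) = inject₁ i
position (r j) = inject₁ j
position {n} _ = fromℕ n

position-locallyInjective : ∀ {n} → LocallyInjective (G n) position
position-locallyInjective {u = l _} {r _} {r _} _ _ e = cong r (inject₁-injective e)
position-locallyInjective {u = l _} {r _} {vl}  _ _ e = ⊥-elim (fromℕ≢inject₁ (sym e))
position-locallyInjective {u = l _} {vl}  {r _} _ _ e = ⊥-elim (fromℕ≢inject₁ e)
position-locallyInjective {u = l _} {vl}  {vl}  _ _ _ = refl
position-locallyInjective {u = r _} {l _} {l _} _ _ e = cong l (inject₁-injective e)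
position-locallyInjective {u = r _} {l _} {vr}  _ _ e = ⊥-elim (fromℕ≢inject₁ (sym e))
position-locallyInjective {u = r _} {vr}  {l _} _ _ e = ⊥-elim (fromℕ≢inject₁ e)
position-locallyInjective {u = r _} {vr}  {vr}  _ _ _ = refl
position-locallyInjective {u = vl}  {l _} {l _} _ _ e = cong l (inject₁-injective e)
position-locallyInjective {u = vl}  {l _} {x₁}  _ _ e = ⊥-elim (fromℕ≢inject₁ (sym e))
position-locallyInjective {u = vl}  {x₁}  {l _} _ _ e = ⊥-elim (fromℕ≢inject₁ e)
position-locallyInjective {u = vl}  {x₁}  {x₁}  _ _ _ = refl
position-locallyInjective {u = vr}  {r _} {r _} _ _ e = cong r (inject₁-injective e)
position-locallyInjective {u = vr}  {r _} {x₂}  _ _ e = ⊥-elim (fromℕ≢inject₁ (sym e))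
position-locallyInjective {u = vr}  {x₂}  {r _} _ _ e = ⊥-elim (fromℕ≢inject₁ e)
position-locallyInjective {u = vr}  {x₂}  {x₂}  _ _ _ = refl
position-locallyInjective {u = x₁}  {vl}  {vl}  _ _ _ = refl
position-locallyInjective {u = x₂}  {vr}  {vr}  _ _ _ = refl

l-injective : ∀ {n} → Injective _≡_ _≡_ (l {n})
l-injective refl = refl

∷r-injective : ∀ {n} {v : GV n} → (∀ j → r j ≢ v) → Injective _≡_ _≡_ (v ∷ r)
∷r-injective _   {zero}  {zero}  _    = refl
∷r-injective r≢v {zero}  {suc j} v≡rj = ⊥-elim (r≢v j (sym v≡rj))
∷r-injective r≢v {suc j} {zero}  rj≡v = ⊥-elim (r≢v j rj≡v)
∷r-injective _   {suc _} {suc _} refl = refl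

module PendantColoursDistinct {n k : ℕ} (c : EdgeColoring (G n) k)
                              (el≢er : colorOf-el c ≢ colorOf-er c) (k≤1+n : k ≤ suc n) where

  α : Fin k
  α = colorOf-el c

  αEdge : Fin n → Fin n → Set
  αEdge i j = col c (l i) (r j) _ ≡ α

  α-at-l : ∀ i → ∃ (αEdge i)
  α-at-l i with every-colour-at c (vl ∷ r) (∷r-injective λ _ ()) (λ { zero → _ ; (suc _) → _ }) k≤1+n α
  ... | zero , e = ⊥-elim (proper c vl (l i) x₁ _ _ (λ ())
                     (trans (col-sym c vl (l i) _ _) (trans e (col-sym c x₁ vl _ _))))
  ... | suc j , e = j , e

  α-at-vr : ∃ λ j → col c vr (r j) _ ≡ α
  α-at-vr with every-colour-at c (x₂ ∷ r) (∷r-injective λ _ ()) (λ { zero → _ ; (suc _) → _ }) k≤1+n α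
  ... | zero , e = ⊥-elim (el≢er (sym (trans (col-sym c x₂ vr _ _) e)))
  ... | suc j , e = j , e

  αEdge-unique-in-L : ∀ {i i′ j} → αEdge i j → αEdge i′ j → i ≡ i′
  αEdge-unique-in-L {i} {i′} {j} e e′ = decidable-stable (i ≟ i′) λ i≢i′ →
    proper c (r j) (l i) (l i′) _ _ (i≢i′ ∘ l-injective)
      (trans (col-sym c (r j) (l i) _ _) (trans e (sym (trans (col-sym c (r j) (l i′) _ _) e′))))

  αEdge-avoids-vr : ∀ {i j} → αEdge i j → col c vr (r j) _ ≡ α → ⊥
  αEdge-avoids-vr {i} {j} e e′ = proper c (r j) (l i) vr _ _ (λ ())
    (trans (col-sym c (r j) (l i) _ _) (trans e (sym (trans (col-sym c (r j) vr _ _) e′))))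

  partner : Fin n → Fin n
  partner i = proj₁ (α-at-l i)

  partner-injective : Injective _≡_ _≡_ partner
  partner-injective {i} {i′} same =
    αEdge-unique-in-L (proj₂ (α-at-l i)) (subst (αEdge i′) (sym same) (proj₂ (α-at-l i′)))

  partner-avoids : ∀ i → partner i ≢ proj₁ α-at-vr
  partner-avoids i same = αEdge-avoids-vr (subst (αEdge i) same (proj₂ (α-at-l i))) (proj₂ α-at-vr)

  impossible : ⊥
  impossible = <-irrefl refl (injective-avoiding⇒< partner partner-injective (proj₁ α-at-vr) partner-avoids)

lemma2 : (n : ℕ) → 1 ≤ n →
    EdgeColorable (G n) (n + 1)
    × ((k : ℕ) (c : EdgeColoring (G n) k) → ¬ colorOf-el c ≡ colorOf-er c → n + 2 ≤ k)
lemma2 n _ = subst (EdgeColoring (G n)) (+-comm 1 n) (labelSumColoring position position-locallyInjective)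
           , lowerBound
  where
  lowerBound : (k : ℕ) (c : EdgeColoring (G n) k) → colorOf-el c ≢ colorOf-er c → n + 2 ≤ k
  lowerBound k c el≢er with n + 2 ≤? k
  ... | yes n+2≤k = n+2≤k
  ... | no n+2≰k = ⊥-elim (PendantColoursDistinct.impossible c el≢er
                     (≤-pred (subst (suc k ≤_) (+-comm n 2) (≰⇒> n+2≰k))))
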